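{- For $n\ge 1$ let $A_n(x)=\sum_{k=1}^n a_{n,k}x^{k-1}$ with $$a_{n,k}=\frac{1}{n!}\binom{n}{k}\left(H_n-H_{n-k}\right),\qquad H_m=\sum_{i=1}^m\frac1i\ (H_0=0).$$ Then $A_n$ is logconcave: $a_{n,k}^2\ge a_{n,k-1}a_{n,k+1}$ for all $2\le k\le n-1$. -}

module Defs where

open import Data.Nat as ℕ using (ℕ; zero; suc; _∸_; _!)
open import Data.Nat.Properties using (_!≢0)
open import Data.Nat.Combinatorics using (_C_)
open import Data.Integer using (+_)
open import Data.Rational using (ℚ; 0ℚ; _+_; _-_; _*_; _/_)

H : ℕ → ℚ
H zero    = 0ℚ
H (suc m) = H m + (+ 1) / suc m

a : ℕ → ℕ → ℚ
a n k = ((+ 1) / (n !)) {{n !≢0}} * ((+ (n C k)) / 1) * (H n - H (n ∸ k))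

{-# OPTIONS --safe #-}
module Submission where

-- With m = n − k, x = C(n,k) and D = H n − H m, so that a n k = c·x·D with c = 1/n!, the identities
-- (k+1)·C(n,k+1) = (n−k)·C(n,k) and j·(H j − H (j−1)) = 1 give
--   a n (k−1) = c·x·k/(m+1)·(D − 1/(m+1))   and   a n (k+1) = c·x·m/(k+1)·(D + 1/m).
-- Clearing denominators, logconcavity becomes k·((m+1)D − 1)(mD + 1) ≤ (k+1)(m+1)²D²,
-- and the two sides differ by (m+1)²D² + k·(mD² + (D − ½)² + ¾) ≥ 0.

open import Defs
open import Data.Nat using (ℕ; _≤_; _<_; suc; _∸_; _!; s≤s; NonZero)
open import Data.Rational using (_*_) renaming (_≤_ to _≤ℚ_)

import Data.Nat as ℕ
import Data.Nat.Properties as ℕ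
open import Data.Nat.Properties using (_!≢0; _!*_!≢0)
open import Data.Nat.Combinatorics using (_C_; nCk≡n!/k![n-k]!; k![n∸k]!∣n!; [n-k]*d[k+1]≡[k+1]*d[k])
open import Data.Nat.DivMod using (m/n*n≡m)
open import Data.Integer.Base using (+_)
import Data.Integer.Base as ℤ
import Data.Integer.Properties as ℤ
import Data.Integer.Tactic.RingSolver as ℤ-Solver
open import Data.Rational using (ℚ; 0ℚ; 1ℚ; ½; _+_; _-_; _/_; toℚᵘ; positive; nonNegative; nonPositive) renaming (_<_ to _<ℚ_)
open import Data.Rational.Properties
import Data.Rational.Unnormalised as ℚᵘ
import Data.Rational.Unnormalised.Properties as ℚᵘ
open import Data.List.Base using (_∷_; [])
open import Data.Sum.Base using (inj₁; inj₂)
open import Level using (0ℓ)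
open import Relation.Binary.PropositionalEquality
open import Relation.Nullary.Decidable.Core using (dec⇒maybe)
import Algebra.Properties.CommutativeSemigroup as CommSemigroupProperties
open import Tactic.RingSolver using (solve-∀; solve)
open import Tactic.RingSolver.Core.AlmostCommutativeRing using (AlmostCommutativeRing; fromCommutativeRing)

nCk*k![n∸k]!≡n! : ∀ {n k} → k ≤ n → (n C k) ℕ.* (k ! ℕ.* (n ∸ k) !) ≡ n !
nCk*k![n∸k]!≡n! {n} {k} k≤n = begin
  (n C k) ℕ.* (k ! ℕ.* (n ∸ k) !)                        ≡⟨ cong (ℕ._* (k ! ℕ.* (n ∸ k) !)) (nCk≡n!/k![n-k]! k≤n) ⟩
  (n ! ℕ./ (k ! ℕ.* (n ∸ k) !)) ℕ.* (k ! ℕ.* (n ∸ k) !) ≡⟨ m/n*n≡m (k![n∸k]!∣n! k≤n) ⟩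
  n !                                                    ∎
  where
  open ≡-Reasoning
  instance
    k!*[n∸k]!≢0 : NonZero (k ! ℕ.* (n ∸ k) !)
    k!*[n∸k]!≢0 = k !* (n ∸ k) !≢0

[k+1]*nC[k+1]≡[n∸k]*nCk : ∀ {n k} → k < n → suc k ℕ.* (n C suc k) ≡ (n ∸ k) ℕ.* (n C k)
[k+1]*nC[k+1]≡[n∸k]*nCk {n} {k} k<n =
  ℕ.*-cancelʳ-≡ (suc k ℕ.* (n C suc k)) ((n ∸ k) ℕ.* (n C k)) d[k+1] {{suc k !* (n ∸ suc k) !≢0}} (trans lhs (sym rhs))
  where
  open ≡-Reasoning
  open CommSemigroupProperties ℕ.*-commutativeSemigroup
  d[k] d[k+1] : ℕ
  d[k]   = k ! ℕ.* (n ∸ k) !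
  d[k+1] = suc k ! ℕ.* (n ∸ suc k) !
  lhs : suc k ℕ.* (n C suc k) ℕ.* d[k+1] ≡ suc k ℕ.* n !
  lhs = trans (ℕ.*-assoc (suc k) (n C suc k) d[k+1]) (cong (suc k ℕ.*_) (nCk*k![n∸k]!≡n! k<n))
  rhs : (n ∸ k) ℕ.* (n C k) ℕ.* d[k+1] ≡ suc k ℕ.* n !
  rhs = begin
    (n ∸ k) ℕ.* (n C k) ℕ.* d[k+1]   ≡⟨ xy∙z≈y∙xz (n ∸ k) (n C k) d[k+1] ⟩
    (n C k) ℕ.* ((n ∸ k) ℕ.* d[k+1]) ≡⟨ cong ((n C k) ℕ.*_) ([n-k]*d[k+1]≡[k+1]*d[k] k<n) ⟩
    (n C k) ℕ.* (suc k ℕ.* d[k])     ≡⟨ x∙yz≈y∙xz (n C k) (suc k) d[k] ⟩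
    suc k ℕ.* ((n C k) ℕ.* d[k])     ≡⟨ cong (suc k ℕ.*_) (nCk*k![n∸k]!≡n! (ℕ.<⇒≤ k<n)) ⟩
    suc k ℕ.* n !                    ∎

fromℕ : ℕ → ℚ
fromℕ m = + m / 1

toℚᵘ-fromℕ : ∀ m → toℚᵘ (fromℕ m) ℚᵘ.≃ ℚᵘ.mkℚᵘ (+ m) 0
toℚᵘ-fromℕ m = toℚᵘ-fromℚᵘ (ℚᵘ.mkℚᵘ (+ m) 0)

fromℕ-suc : ∀ m → fromℕ (suc m) ≡ fromℕ m + 1ℚ
fromℕ-suc m = toℚᵘ-injective (begin
  toℚᵘ (fromℕ (suc m))          ≈⟨ toℚᵘ-fromℕ (suc m) ⟩
  ℚᵘ.mkℚᵘ (+ suc m) 0           ≈⟨ ℚᵘ.*≡* (cross-multiplied (+ m)) ⟩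
  ℚᵘ.mkℚᵘ (+ m) 0 ℚᵘ.+ ℚᵘ.1ℚᵘ   ≈⟨ ℚᵘ.+-congˡ ℚᵘ.1ℚᵘ (ℚᵘ.≃-sym (toℚᵘ-fromℕ m)) ⟩
  toℚᵘ (fromℕ m) ℚᵘ.+ toℚᵘ 1ℚ   ≈⟨ ℚᵘ.≃-sym (toℚᵘ-homo-+ (fromℕ m) 1ℚ) ⟩
  toℚᵘ (fromℕ m + 1ℚ)           ∎)
  where
  open ℚᵘ.≃-Reasoning
  cross-multiplied : ∀ z → (+ 1 ℤ.+ z) ℤ.* + 1 ≡ (z ℤ.* + 1 ℤ.+ + 1 ℤ.* + 1) ℤ.* + 1
  cross-multiplied = ℤ-Solver.solve-∀

fromℕ-*-inverse : ∀ m → fromℕ (suc m) * (+ 1 / suc m) ≡ 1ℚ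
fromℕ-*-inverse m = toℚᵘ-injective (begin
  toℚᵘ (fromℕ (suc m) * (+ 1 / suc m))         ≈⟨ toℚᵘ-homo-* (fromℕ (suc m)) (+ 1 / suc m) ⟩
  toℚᵘ (fromℕ (suc m)) ℚᵘ.* toℚᵘ (+ 1 / suc m) ≈⟨ ℚᵘ.*-cong (toℚᵘ-fromℕ (suc m)) (toℚᵘ-fromℚᵘ (ℚᵘ.mkℚᵘ (+ 1) m)) ⟩
  ℚᵘ.mkℚᵘ (+ suc m) 0 ℚᵘ.* ℚᵘ.mkℚᵘ (+ 1) m    ≈⟨ ℚᵘ.*≡* (cross-multiplied (+ suc m)) ⟩
  ℚᵘ.1ℚᵘ                                       ∎)
  where
  open ℚᵘ.≃-Reasoning
  cross-multiplied : ∀ z → (z ℤ.* + 1) ℤ.* + 1 ≡ + 1 ℤ.* (+ 1 ℤ.* z)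
  cross-multiplied = ℤ-Solver.solve-∀

fromℕ-nonNeg : ∀ m → 0ℚ ≤ℚ fromℕ m
fromℕ-nonNeg m = nonNegative⁻¹ (fromℕ m) {{normalize-nonNeg m 1}}

fromℕ-pos : ∀ m → 0ℚ <ℚ fromℕ (suc m)
fromℕ-pos m = positive⁻¹ (fromℕ (suc m)) {{normalize-pos (suc m) 1}}

fromℕ-* : ∀ m n → fromℕ (m ℕ.* n) ≡ fromℕ m * fromℕ n
fromℕ-* m n = toℚᵘ-injective (begin
  toℚᵘ (fromℕ (m ℕ.* n))                ≈⟨ toℚᵘ-fromℕ (m ℕ.* n) ⟩
  ℚᵘ.mkℚᵘ (+ (m ℕ.* n)) 0               ≈⟨ ℚᵘ.*≡* (cong (ℤ._* + 1) (ℤ.pos-* m n)) ⟩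
  ℚᵘ.mkℚᵘ (+ m) 0 ℚᵘ.* ℚᵘ.mkℚᵘ (+ n) 0  ≈⟨ ℚᵘ.≃-sym (ℚᵘ.*-cong (toℚᵘ-fromℕ m) (toℚᵘ-fromℕ n)) ⟩
  toℚᵘ (fromℕ m) ℚᵘ.* toℚᵘ (fromℕ n)    ≈⟨ ℚᵘ.≃-sym (toℚᵘ-homo-* (fromℕ m) (fromℕ n)) ⟩
  toℚᵘ (fromℕ m * fromℕ n)              ∎)
  where open ℚᵘ.≃-Reasoning

ℚ-ring : AlmostCommutativeRing 0ℓ 0ℓ
ℚ-ring = fromCommutativeRing +-*-commutativeRing (λ p → dec⇒maybe (0ℚ ≟ p))

+-nonNeg : ∀ {p q} → 0ℚ ≤ℚ p → 0ℚ ≤ℚ q → 0ℚ ≤ℚ p + q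
+-nonNeg {p} {q} 0≤p 0≤q = nonNegative⁻¹ (p + q) {{nonNeg+nonNeg⇒nonNeg p {{nonNegative 0≤p}} q {{nonNegative 0≤q}}}}

*-nonNeg : ∀ {p q} → 0ℚ ≤ℚ p → 0ℚ ≤ℚ q → 0ℚ ≤ℚ p * q
*-nonNeg {p} {q} 0≤p 0≤q = nonNegative⁻¹ (p * q) {{nonNeg*nonNeg⇒nonNeg p {{nonNegative 0≤p}} q {{nonNegative 0≤q}}}}

*-pos : ∀ {p q} → 0ℚ <ℚ p → 0ℚ <ℚ q → 0ℚ <ℚ p * q
*-pos {p} {q} 0<p 0<q = positive⁻¹ (p * q) {{pos*pos⇒pos p {{positive 0<p}} q {{positive 0<q}}}}

+1-pos : ∀ {p} → 0ℚ ≤ℚ p → 0ℚ <ℚ p + 1ℚ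
+1-pos {p} 0≤p = positive⁻¹ (p + 1ℚ) {{nonNeg+pos⇒pos p {{nonNegative 0≤p}} 1ℚ}}

square-nonNeg : ∀ p → 0ℚ ≤ℚ p * p
square-nonNeg p with ≤-total 0ℚ p
... | inj₁ 0≤p = *-nonNeg 0≤p 0≤p
... | inj₂ p≤0 = nonNegative⁻¹ (p * p) {{nonPos*nonPos⇒nonPos p {{nonPositive p≤0}} p {{nonPositive p≤0}}}}

quadratic-bound : ∀ {Q K} D → 0ℚ ≤ℚ Q → 0ℚ ≤ℚ K →
  K * (((Q + 1ℚ) * D - 1ℚ) * (Q * D + 1ℚ)) ≤ℚ (K + 1ℚ) * (((Q + 1ℚ) * D) * ((Q + 1ℚ) * D))
quadratic-bound {Q} {K} D 0≤Q 0≤K = begin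
  K * (((Q + 1ℚ) * D - 1ℚ) * (Q * D + 1ℚ))
    ≡⟨ solve (Q ∷ K ∷ D ∷ []) ℚ-ring ⟩
  K * (((Q + 1ℚ) * D - 1ℚ) * (Q * D + 1ℚ)) + 0ℚ
    ≤⟨ +-monoʳ-≤ (K * (((Q + 1ℚ) * D - 1ℚ) * (Q * D + 1ℚ))) 0≤slack ⟩
  K * (((Q + 1ℚ) * D - 1ℚ) * (Q * D + 1ℚ))
    + (((Q + 1ℚ) * D) * ((Q + 1ℚ) * D) + K * (Q * (D * D) + (D - ½) * (D - ½) + (½ * ½ + ½)))
    ≡⟨ solve (Q ∷ K ∷ D ∷ []) ℚ-ring ⟩
  (K + 1ℚ) * (((Q + 1ℚ) * D) * ((Q + 1ℚ) * D)) ∎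
  where
  open ≤-Reasoning
  0≤slack : 0ℚ ≤ℚ ((Q + 1ℚ) * D) * ((Q + 1ℚ) * D) + K * (Q * (D * D) + (D - ½) * (D - ½) + (½ * ½ + ½))
  0≤slack = +-nonNeg (square-nonNeg ((Q + 1ℚ) * D))
    (*-nonNeg 0≤K (+-nonNeg (+-nonNeg (*-nonNeg 0≤Q (square-nonNeg D)) (square-nonNeg (D - ½))) (nonNegative⁻¹ (½ * ½ + ½))))

logconcave-triple : ∀ {c x b₋ b₊ X h₋ h h₊ Q K} → 0ℚ <ℚ Q → 0ℚ ≤ℚ K →
  (Q + 1ℚ) * b₋ ≡ K * x → (K + 1ℚ) * b₊ ≡ Q * x →
  (Q + 1ℚ) * (h₋ - h) ≡ 1ℚ → Q * (h - h₊) ≡ 1ℚ →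
  (c * b₋ * (X - h₋)) * (c * b₊ * (X - h₊)) ≤ℚ (c * x * (X - h)) * (c * x * (X - h))
logconcave-triple {c} {x} {b₋} {b₊} {X} {h₋} {h} {h₊} {Q} {K} 0<Q 0≤K lower upper step₋ step₊ =
  *-cancelˡ-≤-pos ((Q + 1ℚ) * (K + 1ℚ) * (Q + 1ℚ) * Q) {{positive 0<denominators}} (begin
    (Q + 1ℚ) * (K + 1ℚ) * (Q + 1ℚ) * Q * ((c * b₋ * (X - h₋)) * (c * b₊ * (X - h₊)))
      ≡⟨ solve (c ∷ x ∷ b₋ ∷ b₊ ∷ X ∷ h₋ ∷ h ∷ h₊ ∷ Q ∷ K ∷ []) ℚ-ring ⟩
    c * c * ((Q + 1ℚ) * b₋) * ((K + 1ℚ) * b₊)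
      * ((Q + 1ℚ) * (X - h) - (Q + 1ℚ) * (h₋ - h)) * (Q * (X - h) + Q * (h - h₊))
      ≡⟨ cong₂ _*_ (cong₂ _*_ (cong₂ _*_ (cong ((c * c) *_) lower) upper)
                              (cong (((Q + 1ℚ) * (X - h)) -_) step₋))
                   (cong (_+_ (Q * (X - h))) step₊) ⟩
    c * c * (K * x) * (Q * x) * ((Q + 1ℚ) * (X - h) - 1ℚ) * (Q * (X - h) + 1ℚ)
      ≡⟨ solve (c ∷ x ∷ X ∷ h ∷ Q ∷ K ∷ []) ℚ-ring ⟩
    (c * x) * (c * x) * Q * (K * (((Q + 1ℚ) * (X - h) - 1ℚ) * (Q * (X - h) + 1ℚ)))
      ≤⟨ *-monoˡ-≤-nonNeg ((c * x) * (c * x) * Q) {{nonNegative 0≤cxcxQ}}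
           (quadratic-bound (X - h) 0≤Q 0≤K) ⟩
    (c * x) * (c * x) * Q * ((K + 1ℚ) * (((Q + 1ℚ) * (X - h)) * ((Q + 1ℚ) * (X - h))))
      ≡⟨ solve (c ∷ x ∷ X ∷ h ∷ Q ∷ K ∷ []) ℚ-ring ⟩
    (Q + 1ℚ) * (K + 1ℚ) * (Q + 1ℚ) * Q * ((c * x * (X - h)) * (c * x * (X - h))) ∎)
  where
  open ≤-Reasoning
  0≤Q : 0ℚ ≤ℚ Q
  0≤Q = <⇒≤ 0<Q
  0<denominators : 0ℚ <ℚ (Q + 1ℚ) * (K + 1ℚ) * (Q + 1ℚ) * Q
  0<denominators = *-pos (*-pos (*-pos (+1-pos 0≤Q) (+1-pos 0≤K)) (+1-pos 0≤Q)) 0<Q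
  0≤cxcxQ : 0ℚ ≤ℚ (c * x) * (c * x) * Q
  0≤cxcxQ = *-nonNeg (square-nonNeg (c * x)) 0≤Q

fromℕ-binomial-ratio : ∀ {n k} → k < n → fromℕ (suc k) * fromℕ (n C suc k) ≡ fromℕ (n ∸ k) * fromℕ (n C k)
fromℕ-binomial-ratio {n} {k} k<n = begin
  fromℕ (suc k) * fromℕ (n C suc k) ≡⟨ fromℕ-* (suc k) (n C suc k) ⟨
  fromℕ (suc k ℕ.* (n C suc k))     ≡⟨ cong fromℕ ([k+1]*nC[k+1]≡[n∸k]*nCk k<n) ⟩
  fromℕ ((n ∸ k) ℕ.* (n C k))       ≡⟨ fromℕ-* (n ∸ k) (n C k) ⟩
  fromℕ (n ∸ k) * fromℕ (n C k)     ∎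
  where open ≡-Reasoning

H-step : ∀ {m m⁺} → m⁺ ≡ suc m → fromℕ m⁺ * (H m⁺ - H m) ≡ 1ℚ
H-step {m} refl = trans (cong (fromℕ (suc m) *_) (p+q-p≡q (H m) (+ 1 / suc m))) (fromℕ-*-inverse m)
  where
  p+q-p≡q : ∀ p q → p + q - p ≡ q
  p+q-p≡q = solve-∀ ℚ-ring

a-logconcave : ∀ n j → suc j < n → a n j * a n (suc (suc j)) ≤ℚ a n (suc j) * a n (suc j)
a-logconcave n j k<n =
  logconcave-triple {c = (+ 1 / n !) {{n !≢0}}} {X = H n} 0<Q (fromℕ-nonNeg k) lower upper step₋ step₊
  where
  k : ℕ
  k = suc j
  n∸k≡1+n∸[1+k] : n ∸ k ≡ suc (n ∸ suc k)
  n∸k≡1+n∸[1+k] = ℕ.+-∸-assoc 1 k<n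
  n∸j≡1+n∸k : n ∸ j ≡ suc (n ∸ k)
  n∸j≡1+n∸k = ℕ.+-∸-assoc 1 (ℕ.<⇒≤ k<n)
  0<Q : 0ℚ <ℚ fromℕ (n ∸ k)
  0<Q = subst (λ m → 0ℚ <ℚ fromℕ m) (sym n∸k≡1+n∸[1+k]) (fromℕ-pos (n ∸ suc k))
  [n∸k]+1≡n∸j : fromℕ (n ∸ k) + 1ℚ ≡ fromℕ (n ∸ j)
  [n∸k]+1≡n∸j = trans (sym (fromℕ-suc (n ∸ k))) (cong fromℕ (sym n∸j≡1+n∸k))
  lower : (fromℕ (n ∸ k) + 1ℚ) * fromℕ (n C j) ≡ fromℕ k * fromℕ (n C k)
  lower = trans (cong (_* fromℕ (n C j)) [n∸k]+1≡n∸j) (sym (fromℕ-binomial-ratio (ℕ.<⇒≤ k<n)))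
  upper : (fromℕ k + 1ℚ) * fromℕ (n C suc k) ≡ fromℕ (n ∸ k) * fromℕ (n C k)
  upper = trans (cong (_* fromℕ (n C suc k)) (sym (fromℕ-suc k))) (fromℕ-binomial-ratio k<n)
  step₋ : (fromℕ (n ∸ k) + 1ℚ) * (H (n ∸ j) - H (n ∸ k)) ≡ 1ℚ
  step₋ = trans (cong (_* (H (n ∸ j) - H (n ∸ k))) [n∸k]+1≡n∸j) (H-step n∸j≡1+n∸k)
  step₊ : fromℕ (n ∸ k) * (H (n ∸ k) - H (n ∸ suc k)) ≡ 1ℚ
  step₊ = H-step n∸k≡1+n∸[1+k]

theorem4p1 : (n k : ℕ) → 1 ≤ n → 2 ≤ k → k ≤ n ∸ 1 →
    (a n (k ∸ 1) * a n (suc k)) ≤ℚ (a n k * a n k)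
theorem4p1 (suc n) (suc j) (s≤s _) (s≤s _) k≤n = a-logconcave (suc n) j (s≤s k≤n)
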